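{- For every natural number $n$, $$\Phi^*_n(x)=\prod_{\substack{d\mid n\\ \kappa(d)=\kappa(n)}}\Phi_d(x).$$
   Context: $\Phi_d(x)$ denotes the $d$-th cyclotomic polynomial. A divisor $d$ of $n$ is unitary, $d\mid\mid n$, if $\gcd(d,n/d)=1$; $(j,n)_*=\max\{d: d\mid j,\ d\mid\mid n\}$; the unitary cyclotomic polynomial is $\Phi^*_n(x)=\prod_{1\le j\le n,\ (j,n)_*=1}(x-e^{2\pi i j/n})$. $\kappa(n)=\prod_{p\mid n}p$ is the squarefree kernel of $n$ (with $\kappa(1)=1$). -}

module Defs where

import Level
open import Level using (Level)
open import Data.Nat using (ℕ; zero; suc; _⊔_; _<_)
open import Data.Nat.Divisibility using (_∣_; _∣?_)
open import Data.Nat.DivMod using (_/_)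
open import Data.Nat.GCD using (gcd)
open import Data.Nat.Primality using (Prime; prime?)
open import Data.Nat.Properties using (_≟_)
open import Data.List using (List; []; _∷_; map; filter; foldr; upTo)
open import Data.Nat.ListAction using (product)
open import Data.Empty using (⊥)
open import Data.Product using (_×_)
open import Relation.Binary.PropositionalEquality using (_≡_)
open import Relation.Nullary.Decidable using (_×-dec_)
open import Relation.Unary using (Decidable)
open import Algebra.Bundles using (CommutativeRing)
open import Data.List.Relation.Binary.Pointwise using (Pointwise)

range1 : ℕ → List ℕ
range1 n = map suc (upTo n)

-- d is a unitary divisor of n (d ∣∣ n): d ∣ n and gcd(d, n/d) = 1.
-- (Stated for d = suc k so that n / d is defined.)
UnitaryDivisor : ℕ → ℕ → Set
UnitaryDivisor zero    n = zero ∣ n × gcd zero n ≡ 1   -- never used: 0 ∤ n for n ≥ 1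
UnitaryDivisor (suc k) n = suc k ∣ n × gcd (suc k) (n / suc k) ≡ 1

unitaryDivisor? : (n : ℕ) → Decidable (λ d → UnitaryDivisor d n)
unitaryDivisor? n zero    = (zero ∣? n) ×-dec (gcd zero n ≟ 1)
unitaryDivisor? n (suc k) = (suc k ∣? n) ×-dec (gcd (suc k) (n / suc k) ≟ 1)

maximum : List ℕ → ℕ
maximum = foldr _⊔_ 0

-- (j, n)_* = max { d : d ∣ j, d ∣∣ n }  (d ranging over 1..n; every unitary
-- divisor of n ≥ 1 lies in this range, and d = 1 always qualifies)
unitaryGcd : ℕ → ℕ → ℕ
unitaryGcd j n =
  maximum (filter (λ d → (d ∣? j) ×-dec unitaryDivisor? n d) (range1 n))

kernel : ℕ → ℕ
kernel n = product (filter (λ p → prime? p ×-dec (p ∣? n)) (range1 n))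

-- Polynomials over a commutative ring, as coefficient lists
-- (constant coefficient first).

module Poly {c ℓ : Level} (R : CommutativeRing c ℓ) where
  open CommutativeRing R renaming (Carrier to A)

  Pol : Set c
  Pol = List A

  _⊕_ : Pol → Pol → Pol
  []       ⊕ q        = q
  (a ∷ p)  ⊕ []       = a ∷ p
  (a ∷ p)  ⊕ (b ∷ q)  = (a + b) ∷ (p ⊕ q)

  _⊛_ : Pol → Pol → Pol
  []      ⊛ q = []
  (a ∷ p) ⊛ q = map (a *_) q ⊕ (0# ∷ (p ⊛ q))

  one : Pol
  one = 1# ∷ []

  prodP : List Pol → Pol
  prodP = foldr _⊛_ one

  X-_ : A → Pol
  X- a = (- a) ∷ 1# ∷ []

  _≈P_ : Pol → Pol → Set (c Level.⊔ ℓ)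
  _≈P_ = Pointwise _≈_

  pow : A → ℕ → A
  pow a zero    = 1#
  pow a (suc k) = a * pow a k

  PrimitiveRoot : A → ℕ → Set ℓ
  PrimitiveRoot ζ n = pow ζ n ≈ 1# × (∀ k → 0 < k → k < n → pow ζ k ≈ 1# → ⊥)

  cyclotomic : A → ℕ → Pol
  cyclotomic ω d =
    prodP (map (λ k → X- pow ω k) (filter (λ k → gcd k d ≟ 1) (range1 d)))

  unitaryCyclotomic : A → ℕ → Pol
  unitaryCyclotomic ζ n =
    prodP (map (λ j → X- pow ζ j) (filter (λ j → unitaryGcd j n ≟ 1) (range1 n)))

  -- ∏_{d ∣ n, κ(d) = κ(n)} Φ_d(x), where Φ_d uses the primitive d-th root ζ^(n/d)
  kernelCyclotomicProduct : A → ℕ → Pol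
  kernelCyclotomicProduct ζ n =
    prodP (map (λ d → cyclotomic (pow ζ (n / suc d)) (suc d))
               (filter (λ d → (suc d ∣? n) ×-dec (kernel (suc d) ≟ kernel n)) (upTo n)))

-- Both sides are products of linear factors x − ζ^e, and such a product does not depend on the
-- order of its factors, so it suffices to match the exponents as multisets.  Sorting j ∈ [1, n]
-- by g = gcd(j, n) writes j = g k with d = n / g and gcd(k, d) = 1, which is exactly how the
-- exponents of Φ_d(x) = ∏ (x − (ζ^(n/d))^k) occur on the right.  It remains to see that
-- (j, n)_* = 1 precisely when κ(d) = κ(n), i.e. when every prime factor of n divides d.
module Submission where

open import Defs
open import Level using (Level)
open import Data.Nat using (ℕ; suc)
open import Algebra.Bundles using (CommutativeRing)

module Residues where
  open import Data.Nat using (ℕ; zero; suc; _+_; _*_; _^_; _≤_; _<_; z≤n; s≤s; _⊔_; NonZero; _/_; ≢-nonZero; ≢-nonZero⁻¹; nonTrivial⇒n>1; >-nonZero⁻¹)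
  open import Data.Nat.Properties
  open import Data.Nat.Divisibility
  open import Data.Nat.DivMod using (m*n/n≡m; m/n*n≡m; m*[n/m]≡n)
  open import Data.Nat.GCD using (gcd; gcd[m,n]∣m; gcd[m,n]∣n; gcd-greatest; gcd-zeroˡ; c*gcd[m,n]≡gcd[cm,cn])
  open import Data.Nat.Coprimality using (Coprime; coprime-divisor; gcd≡1⇒coprime; coprime⇒gcd≡1; coprime-/gcd)
  open import Data.Nat.Primality using (Prime; prime?; prime⇒nonZero; prime⇒nonTrivial; prime⇒irreducible)
  open import Data.Nat.Primality.Factorisation using (factorise; factorisationHasAllPrimeFactors)
  open import Data.Nat.ListAction using (product)
  open import Data.Nat.ListAction.Properties using (product-↭; ∈⇒∣product)
  open import Data.Nat.Induction using (<-wellFounded)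
  open import Induction.WellFounded using (Acc; acc)
  open import Data.List using (List; []; _∷_; map; filter; upTo; concat)
  open import Data.List.Membership.Propositional using (_∈_)
  open import Data.List.Membership.Propositional.Properties using (∈-map⁺; ∈-map⁻; ∈-filter⁺; ∈-filter⁻; ∈-upTo⁺; ∈-upTo⁻; ∈-concat⁺′; ∈-concat⁻′)
  open import Data.List.Membership.Propositional.Properties.WithK using (unique∧set⇒bag)
  open import Data.List.Relation.Unary.Any using (here; there)
  open import Data.List.Relation.Unary.All as All using (All; []; _∷_)
  open import Data.List.Relation.Unary.All.Properties using (all-filter) renaming (map⁺ to All-map⁺)
  open import Data.List.Relation.Unary.Unique.Propositional using (Unique)
  import Data.List.Relation.Unary.Unique.Propositional.Properties as Unique
  open import Data.List.Relation.Binary.Permutation.Propositional using (_↭_)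
  open import Data.List.Relation.Binary.BagAndSetEquality using (∼bag⇒↭)
  open import Data.Product using (_×_; _,_; proj₁; proj₂; ∃; ∃₂)
  open import Data.Sum using (inj₁; inj₂)
  open import Data.Empty using (⊥; ⊥-elim)
  open import Function using (_⇔_; mk⇔; Equivalence)
  open import Function.Construct.Composition using () renaming (equivalence to ⇔-trans)
  open import Function.Construct.Symmetry using (⇔-sym)
  open import Data.List.Relation.Unary.AllPairs using (AllPairs; []; _∷_)
  open import Data.List.Relation.Binary.Disjoint.Propositional using (Disjoint)
  open import Relation.Nullary using (¬_; yes; no)
  open import Relation.Nullary.Decidable using (_×-dec_)
  open import Relation.Binary.PropositionalEquality using (_≡_; _≢_; refl; cong; sym; trans; subst; subst₂; module ≡-Reasoning)

  range1⁺ : ∀ {x n} → 1 ≤ x → x ≤ n → x ∈ range1 n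
  range1⁺ {suc x} (s≤s _) x≤n = ∈-map⁺ suc (∈-upTo⁺ x≤n)

  range1⁻ : ∀ {x n} → x ∈ range1 n → 1 ≤ x × x ≤ n
  range1⁻ x∈ with ∈-map⁻ suc x∈
  ... | _ , y∈ , refl = s≤s z≤n , ∈-upTo⁻ y∈

  range1-unique : ∀ n → Unique (range1 n)
  range1-unique n = Unique.map⁺ suc-injective (Unique.upTo⁺ n)

  ↭-fromMembership : ∀ {xs ys : List ℕ} → Unique xs → Unique ys → (∀ {x} → x ∈ xs ⇔ x ∈ ys) → xs ↭ ys
  ↭-fromMembership xs! ys! same = ∼bag⇒↭ (unique∧set⇒bag xs! ys! same)

  concat-map-unique : ∀ {A B : Set} {P : A → Set} {f : A → List B} {xs} → Unique xs → All P xs →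
                      (∀ {x} → P x → Unique (f x)) →
                      (∀ {x y b} → P x → P y → b ∈ f x → b ∈ f y → x ≡ y) →
                      Unique (concat (map f xs))
  concat-map-unique {P = P} {f} xs! Pxs f! determines =
    Unique.concat⁺ (All-map⁺ (All.map f! Pxs)) (pairwise xs! Pxs)
    where
    pairwise : ∀ {xs} → Unique xs → All P xs → AllPairs Disjoint (map f xs)
    pairwise []            []          = []
    pairwise (x∉ys ∷ ys!) (Px ∷ Pys) = apart x∉ys Pys ∷ pairwise ys! Pys
      where
      apart : ∀ {ys} → All (_ ≢_) ys → All P ys → All (Disjoint (f _)) (map f ys)
      apart []           []         = []
      apart (x≢y ∷ x≢ys) (Py ∷ Pys) = (λ (b∈fx , b∈fy) → x≢y (determines Px Py b∈fx b∈fy)) ∷ apart x≢ys Pys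

  ∣-nonZero : ∀ {d n} .{{_ : NonZero n}} → d ∣ n → NonZero d
  ∣-nonZero {zero} {n} 0∣n = ⊥-elim (≢-nonZero⁻¹ n (0∣⇒≡0 0∣n))
  ∣-nonZero {suc _} _ = _

  *≡nonZero⇒nonZeroˡ : ∀ {a b n} .{{_ : NonZero n}} → a * b ≡ n → NonZero a
  *≡nonZero⇒nonZeroˡ {zero} {n = n} 0≡n = ⊥-elim (≢-nonZero⁻¹ n (sym 0≡n))
  *≡nonZero⇒nonZeroˡ {suc _} _ = _

  prime>1 : ∀ {p} → Prime p → 1 < p
  prime>1 {p} pp = nonTrivial⇒n>1 p {{prime⇒nonTrivial pp}}

  primeDivisors : ℕ → List ℕ
  primeDivisors n = filter (λ p → prime? p ×-dec (p ∣? n)) (range1 n)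

  ∈-primeDivisors⁺ : ∀ {p n} .{{_ : NonZero n}} → Prime p → p ∣ n → p ∈ primeDivisors n
  ∈-primeDivisors⁺ pp p∣n = ∈-filter⁺ _ (range1⁺ (<⇒≤ (prime>1 pp)) (∣⇒≤ p∣n)) (pp , p∣n)

  ∈-primeDivisors⁻ : ∀ {p n} → p ∈ primeDivisors n → Prime p × p ∣ n
  ∈-primeDivisors⁻ {n = n} p∈ = proj₂ (∈-filter⁻ (λ p → prime? p ×-dec (p ∣? n)) {xs = range1 n} p∈)

  kernel-cong : ∀ {m n} .{{_ : NonZero m}} .{{_ : NonZero n}} →
                (∀ {p} → Prime p → p ∣ m ⇔ p ∣ n) → kernel m ≡ kernel n
  kernel-cong {m} {n} same = product-↭ (↭-fromMembership (unique m) (unique n) (mk⇔ to from))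
    where
    unique : ∀ k → Unique (primeDivisors k)
    unique k = Unique.filter⁺ (λ p → prime? p ×-dec (p ∣? k)) (range1-unique k)
    to : ∀ {p} → p ∈ primeDivisors m → p ∈ primeDivisors n
    to p∈ with pp , p∣m ← ∈-primeDivisors⁻ p∈ = ∈-primeDivisors⁺ pp (Equivalence.to (same pp) p∣m)
    from : ∀ {p} → p ∈ primeDivisors n → p ∈ primeDivisors m
    from p∈ with pp , p∣n ← ∈-primeDivisors⁻ p∈ = ∈-primeDivisors⁺ pp (Equivalence.from (same pp) p∣n)

  kernel≡⇒∣ : ∀ {m n p} .{{_ : NonZero n}} → kernel m ≡ kernel n → Prime p → p ∣ n → p ∣ m
  kernel≡⇒∣ {m} {n} {p} κm≡κn pp p∣n =
    proj₂ (∈-primeDivisors⁻ (factorisationHasAllPrimeFactors pp p∣κm allPrime))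
    where
    p∣κm : p ∣ kernel m
    p∣κm = subst (p ∣_) (sym κm≡κn) (∈⇒∣product (∈-primeDivisors⁺ pp p∣n))
    allPrime : All Prime (primeDivisors m)
    allPrime = All.map proj₁ (all-filter (λ p → prime? p ×-dec (p ∣? m)) (range1 m))

  KernelDivides : ℕ → ℕ → Set
  KernelDivides n d = ∀ {p} → Prime p → p ∣ n → p ∣ d

  kernel≡⇔kernelDivides : ∀ {d n} .{{_ : NonZero n}} → d ∣ n → kernel d ≡ kernel n ⇔ KernelDivides n d
  kernel≡⇔kernelDivides {d} {n} d∣n = mk⇔ {B = KernelDivides n d} (λ κd≡κn → kernel≡⇒∣ κd≡κn) same-kernel
    where
    same-kernel : KernelDivides n d → kernel d ≡ kernel n
    same-kernel κn∣d = kernel-cong {{∣-nonZero d∣n}} (λ pp → mk⇔ (λ p∣d → ∣-trans p∣d d∣n) (κn∣d pp))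

  ∈⇒≤maximum : ∀ {x xs} → x ∈ xs → x ≤ maximum xs
  ∈⇒≤maximum {xs = y ∷ ys} (here refl) = m≤m⊔n y (maximum ys)
  ∈⇒≤maximum {xs = y ∷ ys} (there x∈) = ≤-trans (∈⇒≤maximum x∈) (m≤n⊔m y (maximum ys))

  maximum≤ : ∀ {b xs} → All (_≤ b) xs → maximum xs ≤ b
  maximum≤ []         = z≤n
  maximum≤ (x≤b ∷ xs≤b) = ⊔-lub x≤b (maximum≤ xs≤b)

  unitaryDivisor⁺ : ∀ {u n} .{{_ : NonZero u}} → u ∣ n → gcd u (n / u) ≡ 1 → UnitaryDivisor u n
  unitaryDivisor⁺ {suc _} u∣n coprime = u∣n , coprime

  unitaryDivisor⁻ : ∀ {u n} .{{_ : NonZero u}} → UnitaryDivisor u n → u ∣ n × gcd u (n / u) ≡ 1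
  unitaryDivisor⁻ {suc _} ud = ud

  UnitarilyCoprime : ℕ → ℕ → Set
  UnitarilyCoprime j n = ∀ u → 1 < u → u ∣ j → UnitaryDivisor u n → ⊥

  unitaryGcd≡1⇔unitarilyCoprime : ∀ j n .{{_ : NonZero n}} → unitaryGcd j n ≡ 1 ⇔ UnitarilyCoprime j n
  unitaryGcd≡1⇔unitarilyCoprime j n = mk⇔ ⇒coprime ⇐coprime
    where
    candidates = filter (λ d → (d ∣? j) ×-dec unitaryDivisor? n d) (range1 n)

    candidate⁺ : ∀ {u} .{{_ : NonZero u}} → u ∣ j → UnitaryDivisor u n → u ∈ candidates
    candidate⁺ {u} u∣j ud =
      ∈-filter⁺ _ (range1⁺ (>-nonZero⁻¹ u) (∣⇒≤ (proj₁ (unitaryDivisor⁻ ud)))) (u∣j , ud)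

    ⇒coprime : unitaryGcd j n ≡ 1 → UnitarilyCoprime j n
    ⇒coprime ug≡1 (suc u) 1<u u∣j ud =
      <⇒≱ 1<u (subst (suc u ≤_) ug≡1 (∈⇒≤maximum (candidate⁺ u∣j ud)))

    ⇐coprime : UnitarilyCoprime j n → unitaryGcd j n ≡ 1
    ⇐coprime coprime = ≤-antisym (maximum≤ (All.tabulate at-most-1))
                                  (∈⇒≤maximum (candidate⁺ (1∣ j) (unitaryDivisor⁺ (1∣ n) (gcd-zeroˡ (n / 1)))))
      where
      at-most-1 : ∀ {u} → u ∈ candidates → u ≤ 1
      at-most-1 {u} u∈ with ∈-filter⁻ (λ d → (d ∣? j) ×-dec unitaryDivisor? n d) {xs = range1 n} u∈
      ... | _ , u∣j , ud with u ≤? 1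
      ...   | yes u≤1 = u≤1
      ...   | no  u≰1 = ⊥-elim (coprime u (≰⇒> u≰1) u∣j ud)

  prime∤⇒coprime : ∀ {p m} → Prime p → ¬ p ∣ m → Coprime p m
  prime∤⇒coprime pp p∤m (i∣p , i∣m) with prime⇒irreducible pp i∣p
  ... | inj₁ i≡1  = i≡1
  ... | inj₂ refl = ⊥-elim (p∤m i∣m)

  coprime-*ˡ : ∀ {a b m} → Coprime a m → Coprime b m → Coprime (a * b) m
  coprime-*ˡ {a} a⊥m b⊥m {i} (i∣ab , i∣m) = b⊥m (coprime-divisor i⊥a i∣ab , i∣m)
    where
    i⊥a : Coprime i a
    i⊥a = gcd≡1⇒coprime (a⊥m (gcd[m,n]∣n i a , ∣-trans (gcd[m,n]∣m i a) i∣m))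

  coprime-^ˡ : ∀ {a m} → Coprime a m → ∀ e → Coprime (a ^ e) m
  coprime-^ˡ a⊥m zero    (i∣1 , _) = ∣1⇒≡1 i∣1
  coprime-^ˡ a⊥m (suc e)           = coprime-*ˡ a⊥m (coprime-^ˡ a⊥m e)

  ∃-primeFactor : ∀ {u} → 1 < u → ∃ λ p → Prime p × p ∣ u
  ∃-primeFactor {suc u} 1<u with factorise (suc u)
  ... | record { factors = [] ; isFactorisation = u≡1 } = ⊥-elim (<⇒≢ 1<u (sym u≡1))
  ... | record { factors = p ∷ ps ; isFactorisation = u≡p*ps ; factorsPrime = pp ∷ _ } =
    p , pp , subst (p ∣_) (sym u≡p*ps) (m∣m*n (product ps))

  primePower-split : ∀ {p} → Prime p → ∀ n .{{_ : NonZero n}} → ∃₂ λ e r → n ≡ p ^ e * r × ¬ p ∣ r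
  primePower-split {p} pp n = go n (<-wellFounded n)
    where
    go : ∀ n .{{_ : NonZero n}} → Acc _<_ n → ∃₂ λ e r → n ≡ p ^ e * r × ¬ p ∣ r
    go n (acc smaller) with p ∣? n
    ... | no p∤n = 0 , n , sym (+-identityʳ n) , p∤n
    ... | yes (divides q n≡q*p) = extend (go q {{q≢0}} (smaller q<n))
      where
      q≢0 : NonZero q
      q≢0 = ≢-nonZero λ { refl → ≢-nonZero⁻¹ n n≡q*p }
      q<n : q < n
      q<n = subst (q <_) (sym n≡q*p) (m<m*n q p {{q≢0}} (prime>1 pp))
      extend : (∃₂ λ e r → q ≡ p ^ e * r × ¬ p ∣ r) → ∃₂ λ e r → n ≡ p ^ e * r × ¬ p ∣ r
      extend (e , r , q≡pᵉr , p∤r) = suc e , r , n≡ , p∤r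
        where
        open ≡-Reasoning
        n≡ : n ≡ p * p ^ e * r
        n≡ = begin
          n              ≡⟨ n≡q*p ⟩
          q * p          ≡⟨ cong (_* p) q≡pᵉr ⟩
          p ^ e * r * p  ≡⟨ *-comm (p ^ e * r) p ⟩
          p * (p ^ e * r) ≡⟨ *-assoc p (p ^ e) r ⟨
          p * p ^ e * r  ∎

  unitarilyCoprime⇔kernelDivides : ∀ {j n d} .{{_ : NonZero n}} → gcd j n * d ≡ n →
                                    UnitarilyCoprime j n ⇔ KernelDivides n d
  unitarilyCoprime⇔kernelDivides {j} {n} {d} g*d≡n = mk⇔ {B = KernelDivides n d} (λ h → ⇒κ∣ h) ⇐κ∣
    where
    g = gcd j n

    -- the full p-part of n is a unitary divisor, and it divides j as soon as p ∤ d
    ⇒κ∣ : UnitarilyCoprime j n → KernelDivides n d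
    ⇒κ∣ coprime {p} pp p∣n with p ∣? d | primePower-split pp n
    ... | yes p∣d | _ = p∣d
    ... | no _    | zero , r , n≡r , p∤r = ⊥-elim (p∤r (subst (p ∣_) (trans n≡r (+-identityʳ r)) p∣n))
    ... | no p∤d  | suc e , r , n≡ur , p∤r =
      ⊥-elim (coprime u u>1 u∣j (unitaryDivisor⁺ u∣n (coprime⇒gcd≡1 (subst (Coprime u) (sym n/u≡r) u⊥r))))
      where
      instance
        pᵉ≢0 : NonZero (p ^ e)
        pᵉ≢0 = m^n≢0 p e {{prime⇒nonZero pp}}
        u≢0 : NonZero (p ^ suc e)
        u≢0 = m^n≢0 p (suc e) {{prime⇒nonZero pp}}
      u = p ^ suc e
      u>1 : 1 < u
      u>1 = <-≤-trans (prime>1 pp) (m≤m*n p (p ^ e))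
      u∣n : u ∣ n
      u∣n = divides r (trans n≡ur (*-comm u r))
      u∣j : u ∣ j
      u∣j = ∣-trans (coprime-divisor (coprime-^ˡ (prime∤⇒coprime pp p∤d) (suc e))
                                     (subst (u ∣_) (trans (sym g*d≡n) (*-comm g d)) u∣n))
                    (gcd[m,n]∣m j n)
      n/u≡r : n / u ≡ r
      n/u≡r = trans (cong (_/ u) (trans n≡ur (*-comm u r))) (m*n/n≡m r u)
      u⊥r : Coprime u r
      u⊥r = coprime-^ˡ (prime∤⇒coprime pp p∤r) (suc e)

    -- a prime factor of a unitary divisor u ∣ gcd j n would divide both u and n / u
    ⇐κ∣ : KernelDivides n d → UnitarilyCoprime j n
    ⇐κ∣ κn∣d u@(suc _) 1<u u∣j (u∣n , u⊥n/u)
      with p , pp , p∣u ← ∃-primeFactor 1<u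
      with divides t g≡t*u ← gcd-greatest u∣j u∣n =
      <⇒≢ (prime>1 pp) (sym (gcd≡1⇒coprime u⊥n/u (p∣u , p∣n/u)))
      where
      n≡t*d*u : n ≡ t * d * u
      n≡t*d*u = begin
        n          ≡⟨ g*d≡n ⟨
        g * d      ≡⟨ cong (_* d) g≡t*u ⟩
        t * u * d  ≡⟨ *-assoc t u d ⟩
        t * (u * d) ≡⟨ cong (t *_) (*-comm u d) ⟩
        t * (d * u) ≡⟨ *-assoc t d u ⟨
        t * d * u  ∎
        where open ≡-Reasoning
      p∣n/u : p ∣ n / u
      p∣n/u = subst (p ∣_) (sym (trans (cong (_/ u) n≡t*d*u) (m*n/n≡m (t * d) u)))
                    (∣n⇒∣m*n t (κn∣d pp (∣-trans p∣u u∣n)))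

  unitaryGcd≡1⇔kernel≡ : ∀ {j n d} .{{_ : NonZero n}} → gcd j n * d ≡ n →
                          unitaryGcd j n ≡ 1 ⇔ kernel d ≡ kernel n
  unitaryGcd≡1⇔kernel≡ {j} {n} g*d≡n =
    ⇔-trans (unitaryGcd≡1⇔unitarilyCoprime j n)
    (⇔-trans (unitarilyCoprime⇔kernelDivides g*d≡n)
             (⇔-sym (kernel≡⇔kernelDivides (divides (gcd j n) (sym g*d≡n)))))

  coprimeResidues : ℕ → List ℕ
  coprimeResidues d = filter (λ k → gcd k d ≟ 1) (range1 d)

  gcdClass : ℕ → ℕ → List ℕ
  gcdClass n d = map (n / suc d *_) (coprimeResidues (suc d))

  ∈-gcdClass⇔ : ∀ {j n d} .{{_ : NonZero n}} → suc d ∣ n →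
                j ∈ gcdClass n d ⇔ (j ∈ range1 n × gcd j n * suc d ≡ n)
  ∈-gcdClass⇔ {j} {n} {d} D∣n = mk⇔ ⇒ ⇐
    where
    D = suc d
    c = n / D
    c*D≡n : c * D ≡ n
    c*D≡n = m/n*n≡m D∣n
    instance
      c≢0 : NonZero c
      c≢0 = *≡nonZero⇒nonZeroˡ c*D≡n

    ⇒ : j ∈ gcdClass n d → j ∈ range1 n × gcd j n * D ≡ n
    ⇒ j∈ with ∈-map⁻ (c *_) j∈
    ... | k , k∈ , refl with ∈-filter⁻ (λ k → gcd k D ≟ 1) {xs = range1 D} k∈
    ... | k∈range , k⊥D with range1⁻ {n = D} k∈range
    ... | 1≤k , k≤D = range1⁺ (*-mono-≤ (>-nonZero⁻¹ c) 1≤k) (subst (c * k ≤_) c*D≡n (*-monoʳ-≤ c k≤D))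
                    , trans (cong (_* D) gcd≡c) c*D≡n
      where
      open ≡-Reasoning
      gcd≡c : gcd (c * k) n ≡ c
      gcd≡c = begin
        gcd (c * k) n        ≡⟨ cong (gcd (c * k)) c*D≡n ⟨
        gcd (c * k) (c * D)  ≡⟨ c*gcd[m,n]≡gcd[cm,cn] c k D ⟨
        c * gcd k D          ≡⟨ cong (c *_) k⊥D ⟩
        c * 1                ≡⟨ *-identityʳ c ⟩
        c                    ∎

    ⇐ : j ∈ range1 n × gcd j n * D ≡ n → j ∈ gcdClass n d
    ⇐ (j∈range , g*D≡n) = subst (_∈ gcdClass n d) c*k≡j (∈-map⁺ (c *_) k∈)
      where
      g = gcd j n
      instance
        g≢0 : NonZero g
        g≢0 = *≡nonZero⇒nonZeroˡ g*D≡n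
      k = j / g
      c≡g : c ≡ g
      c≡g = trans (cong (_/ D) (sym g*D≡n)) (m*n/n≡m g D)
      g*k≡j : g * k ≡ j
      g*k≡j = m*[n/m]≡n (gcd[m,n]∣m j n)
      c*k≡j : c * k ≡ j
      c*k≡j = trans (cong (_* k) c≡g) g*k≡j
      n/g≡D : n / g ≡ D
      n/g≡D = trans (cong (_/ g) (trans (sym g*D≡n) (*-comm g D))) (m*n/n≡m D g)
      1≤k : 1 ≤ k
      1≤k with k | g*k≡j
      ... | zero  | g*0≡j = ⊥-elim (<⇒≢ (proj₁ (range1⁻ j∈range)) (sym (trans (sym g*0≡j) (*-zeroʳ g))))
      ... | suc _ | _     = s≤s z≤n
      k≤D : k ≤ D
      k≤D = *-cancelˡ-≤ g (subst₂ _≤_ (sym g*k≡j) (sym g*D≡n) (proj₂ (range1⁻ j∈range)))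
      k∈ : k ∈ coprimeResidues D
      k∈ = ∈-filter⁺ (λ k → gcd k D ≟ 1) (range1⁺ 1≤k k≤D)
                     (coprime⇒gcd≡1 (subst (Coprime k) n/g≡D (coprime-/gcd j n)))

  gcdClass-unique : ∀ {n d} .{{_ : NonZero n}} → suc d ∣ n → Unique (gcdClass n d)
  gcdClass-unique {n} {d} D∣n = Unique.map⁺ (*-cancelˡ-≡ _ _ (n / suc d) {{*≡nonZero⇒nonZeroˡ (m/n*n≡m D∣n)}})
                                  (Unique.filter⁺ (λ k → gcd k (suc d) ≟ 1) (range1-unique (suc d)))

  gcdClass-determines : ∀ {j n d e} .{{_ : NonZero n}} → suc d ∣ n → suc e ∣ n →
                        j ∈ gcdClass n d → j ∈ gcdClass n e → d ≡ e
  gcdClass-determines {j} {n} D∣n E∣n j∈D j∈E =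
    suc-injective (*-cancelˡ-≡ _ _ (gcd j n) {{*≡nonZero⇒nonZeroˡ g*D≡n}} (trans g*D≡n (sym g*E≡n)))
    where
    g*D≡n = proj₂ (Equivalence.to (∈-gcdClass⇔ D∣n) j∈D)
    g*E≡n = proj₂ (Equivalence.to (∈-gcdClass⇔ E∣n) j∈E)

  unitaryResidues : ℕ → List ℕ
  unitaryResidues n = filter (λ j → unitaryGcd j n ≟ 1) (range1 n)

  -- d stands for the divisor d + 1, as in kernelCyclotomicProduct
  kernelDivisors : ℕ → List ℕ
  kernelDivisors n = filter (λ d → (suc d ∣? n) ×-dec (kernel (suc d) ≟ kernel n)) (upTo n)

  unitaryResidues↭gcdClasses : ∀ n .{{_ : NonZero n}} →
                               unitaryResidues n ↭ concat (map (gcdClass n) (kernelDivisors n))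
  unitaryResidues↭gcdClasses n = ↭-fromMembership
    (Unique.filter⁺ (λ j → unitaryGcd j n ≟ 1) (range1-unique n))
    (concat-map-unique (Unique.filter⁺ kernelDivisor? (Unique.upTo⁺ n))
                       (all-filter kernelDivisor? (upTo n))
                       (λ (D∣n , _) → gcdClass-unique D∣n)
                       (λ (D∣n , _) (E∣n , _) → gcdClass-determines D∣n E∣n))
    (mk⇔ to from)
    where
    kernelDivisor? = λ d → (suc d ∣? n) ×-dec (kernel (suc d) ≟ kernel n)

    to : ∀ {j} → j ∈ unitaryResidues n → j ∈ concat (map (gcdClass n) (kernelDivisors n))
    to {j} j∈ with j∈range , ug≡1 ← ∈-filter⁻ (λ j → unitaryGcd j n ≟ 1) {xs = range1 n} j∈
              with gcd[m,n]∣n j n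
    ... | divides zero n≡0 = ⊥-elim (≢-nonZero⁻¹ n n≡0)
    ... | divides (suc d) n≡D*g =
      ∈-concat⁺′ (Equivalence.from (∈-gcdClass⇔ D∣n) (j∈range , g*D≡n))
                 (∈-map⁺ (gcdClass n) (∈-filter⁺ kernelDivisor? (∈-upTo⁺ (∣⇒≤ D∣n)) (D∣n , κD≡κn)))
      where
      g*D≡n : gcd j n * suc d ≡ n
      g*D≡n = trans (*-comm (gcd j n) (suc d)) (sym n≡D*g)
      D∣n : suc d ∣ n
      D∣n = divides (gcd j n) (sym g*D≡n)
      κD≡κn : kernel (suc d) ≡ kernel n
      κD≡κn = Equivalence.to (unitaryGcd≡1⇔kernel≡ g*D≡n) ug≡1

    from : ∀ {j} → j ∈ concat (map (gcdClass n) (kernelDivisors n)) → j ∈ unitaryResidues n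
    from {j} j∈ with class , j∈class , class∈ ← ∈-concat⁻′ (map (gcdClass n) (kernelDivisors n)) j∈
                with d , d∈ , refl ← ∈-map⁻ (gcdClass n) class∈
                with _ , D∣n , κD≡κn ← ∈-filter⁻ kernelDivisor? {xs = upTo n} d∈
                with j∈range , g*D≡n ← Equivalence.to (∈-gcdClass⇔ D∣n) j∈class =
      ∈-filter⁺ (λ j → unitaryGcd j n ≟ 1) j∈range (Equivalence.from (unitaryGcd≡1⇔kernel≡ g*D≡n) κD≡κn)


module Polynomials where
  open import Data.Nat using (suc; _≤_; z≤n; s≤s)
  open import Data.Nat.Properties using (≤-refl; ≤-trans; n≤1+n; ≤-reflexive)
  open import Data.List using (List; []; _∷_; map; foldr; length)
  open import Data.List.Properties using (length-map)
  open import Data.List.Relation.Unary.All using (All; []; _∷_)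
  open import Data.List.Relation.Binary.Pointwise as Pointwise using (Pointwise; []; _∷_)
  open import Data.List.Relation.Binary.Permutation.Propositional as ↭ using (_↭_)
  open import Data.Unit using (⊤)
  open import Data.Empty using (⊥)
  open import Relation.Binary.Bundles using (Setoid)
  open import Relation.Binary.PropositionalEquality as ≡ using (_≡_)

  -- [] ⊛ q is [] rather than a list of zeros, so several ⊛ identities need non-empty factors
  NonEmpty : ∀ {a} {X : Set a} → List X → Set
  NonEmpty []      = ⊥
  NonEmpty (_ ∷ _) = ⊤

  module LinearFactors {c ℓ : Level} (R : CommutativeRing c ℓ) where
    open CommutativeRing R renaming (Carrier to A)
    open Poly R

    polySetoid : Setoid c (c Level.⊔ ℓ)
    polySetoid = Pointwise.setoid setoid

    open Setoid polySetoid public using ()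
      renaming (refl to ≈P-refl; sym to ≈P-sym; trans to ≈P-trans; reflexive to ≡⇒≈P)
    open import Relation.Binary.Reasoning.Setoid polySetoid

    scale : A → Pol → Pol
    scale a = map (a *_)

    ⊕-cong : ∀ {p p′ q q′} → p ≈P p′ → q ≈P q′ → (p ⊕ q) ≈P (p′ ⊕ q′)
    ⊕-cong []       q≈q′      = q≈q′
    ⊕-cong (a ∷ p≈) []        = a ∷ p≈
    ⊕-cong (a ∷ p≈) (b ∷ q≈)  = +-cong a b ∷ ⊕-cong p≈ q≈

    ⊕-congˡ : ∀ p {q q′} → q ≈P q′ → (p ⊕ q) ≈P (p ⊕ q′)
    ⊕-congˡ p = ⊕-cong ≈P-refl

    ⊕-congʳ : ∀ {p p′} q → p ≈P p′ → (p ⊕ q) ≈P (p′ ⊕ q)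
    ⊕-congʳ q p≈p′ = ⊕-cong p≈p′ ≈P-refl

    ⊕-identityʳ : ∀ p → (p ⊕ []) ≡ p
    ⊕-identityʳ []      = ≡.refl
    ⊕-identityʳ (_ ∷ _) = ≡.refl

    ⊕-comm : ∀ p q → (p ⊕ q) ≈P (q ⊕ p)
    ⊕-comm []      []      = []
    ⊕-comm []      (_ ∷ _) = ≈P-refl
    ⊕-comm (_ ∷ _) []      = ≈P-refl
    ⊕-comm (a ∷ p) (b ∷ q) = +-comm a b ∷ ⊕-comm p q

    ⊕-assoc : ∀ p q r → ((p ⊕ q) ⊕ r) ≈P (p ⊕ (q ⊕ r))
    ⊕-assoc []      q       r       = ≈P-refl
    ⊕-assoc (_ ∷ _) []      r       = ≈P-refl
    ⊕-assoc (_ ∷ _) (_ ∷ _) []      = ≈P-refl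
    ⊕-assoc (a ∷ p) (b ∷ q) (d ∷ r) = +-assoc a b d ∷ ⊕-assoc p q r

    ⊕-medial : ∀ p q r s → ((p ⊕ q) ⊕ (r ⊕ s)) ≈P ((p ⊕ r) ⊕ (q ⊕ s))
    ⊕-medial p q r s = begin
      (p ⊕ q) ⊕ (r ⊕ s)  ≈⟨ ⊕-assoc p q (r ⊕ s) ⟩
      p ⊕ (q ⊕ (r ⊕ s))  ≈⟨ ⊕-congˡ p (⊕-assoc q r s) ⟨
      p ⊕ ((q ⊕ r) ⊕ s)  ≈⟨ ⊕-congˡ p (⊕-congʳ s (⊕-comm q r)) ⟩
      p ⊕ ((r ⊕ q) ⊕ s)  ≈⟨ ⊕-congˡ p (⊕-assoc r q s) ⟩
      p ⊕ (r ⊕ (q ⊕ s))  ≈⟨ ⊕-assoc p r (q ⊕ s) ⟨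
      (p ⊕ r) ⊕ (q ⊕ s)  ∎

    ⊕-zerosˡ : ∀ {z} r → All (_≈ 0#) z → length z ≤ length r → (z ⊕ r) ≈P r
    ⊕-zerosˡ r       []       _         = ≈P-refl
    ⊕-zerosˡ (b ∷ r) (z≈0 ∷ zs) (s≤s l) = trans (+-congʳ z≈0) (+-identityˡ b) ∷ ⊕-zerosˡ r zs l

    length-⊕ˡ : ∀ p q → length p ≤ length (p ⊕ q)
    length-⊕ˡ []      q       = z≤n
    length-⊕ˡ (_ ∷ _) []      = ≤-refl
    length-⊕ˡ (_ ∷ p) (_ ∷ q) = s≤s (length-⊕ˡ p q)

    scale-cong : ∀ {a b p q} → a ≈ b → p ≈P q → scale a p ≈P scale b q
    scale-cong a≈b []       = []
    scale-cong a≈b (x ∷ p≈) = *-cong a≈b x ∷ scale-cong a≈b p≈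

    scale-distribˡ : ∀ a p q → scale a (p ⊕ q) ≈P (scale a p ⊕ scale a q)
    scale-distribˡ a []      q       = ≈P-refl
    scale-distribˡ a (_ ∷ _) []      = ≈P-refl
    scale-distribˡ a (x ∷ p) (y ∷ q) = distribˡ a x y ∷ scale-distribˡ a p q

    scale-distribʳ : ∀ a b p → scale (a + b) p ≈P (scale a p ⊕ scale b p)
    scale-distribʳ a b []      = []
    scale-distribʳ a b (x ∷ p) = distribʳ x a b ∷ scale-distribʳ a b p

    scale-assoc : ∀ a b p → scale a (scale b p) ≈P scale (a * b) p
    scale-assoc a b []      = []
    scale-assoc a b (x ∷ p) = sym (*-assoc a b x) ∷ scale-assoc a b p

    scale-identity : ∀ p → scale 1# p ≈P p
    scale-identity []      = []
    scale-identity (x ∷ p) = *-identityˡ x ∷ scale-identity p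

    scale-zero : ∀ p → All (_≈ 0#) (scale 0# p)
    scale-zero []      = []
    scale-zero (x ∷ p) = zeroˡ x ∷ scale-zero p

    ⊛-congˡ : ∀ {p p′} q → p ≈P p′ → (p ⊛ q) ≈P (p′ ⊛ q)
    ⊛-congˡ q []       = []
    ⊛-congˡ q (a ∷ p≈) = ⊕-cong (scale-cong a ≈P-refl) (refl ∷ ⊛-congˡ q p≈)

    ⊛-congʳ : ∀ p {q q′} → q ≈P q′ → (p ⊛ q) ≈P (p ⊛ q′)
    ⊛-congʳ []      q≈ = []
    ⊛-congʳ (a ∷ p) q≈ = ⊕-cong (scale-cong refl q≈) (refl ∷ ⊛-congʳ p q≈)

    ⊛-distribʳ : ∀ p p′ q → ((p ⊕ p′) ⊛ q) ≈P ((p ⊛ q) ⊕ (p′ ⊛ q))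
    ⊛-distribʳ []      p′       q = ≈P-refl
    ⊛-distribʳ (a ∷ p) []       q = ≡⇒≈P (≡.sym (⊕-identityʳ ((a ∷ p) ⊛ q)))
    ⊛-distribʳ (a ∷ p) (b ∷ p′) q = begin
      scale (a + b) q ⊕ (0# ∷ (p ⊕ p′) ⊛ q)
        ≈⟨ ⊕-cong (scale-distribʳ a b q) (sym (+-identityʳ 0#) ∷ ⊛-distribʳ p p′ q) ⟩
      (scale a q ⊕ scale b q) ⊕ ((0# ∷ p ⊛ q) ⊕ (0# ∷ p′ ⊛ q))
        ≈⟨ ⊕-medial (scale a q) (scale b q) (0# ∷ p ⊛ q) (0# ∷ p′ ⊛ q) ⟩
      (scale a q ⊕ (0# ∷ p ⊛ q)) ⊕ (scale b q ⊕ (0# ∷ p′ ⊛ q))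
        ∎

    ⊛-scaleˡ : ∀ a p q → (scale a p ⊛ q) ≈P scale a (p ⊛ q)
    ⊛-scaleˡ a []      q = []
    ⊛-scaleˡ a (x ∷ p) q = begin
      scale (a * x) q ⊕ (0# ∷ scale a p ⊛ q)
        ≈⟨ ⊕-cong (≈P-sym (scale-assoc a x q)) (sym (zeroʳ a) ∷ ⊛-scaleˡ a p q) ⟩
      scale a (scale x q) ⊕ scale a (0# ∷ p ⊛ q)
        ≈⟨ scale-distribˡ a (scale x q) (0# ∷ p ⊛ q) ⟨
      scale a (scale x q ⊕ (0# ∷ p ⊛ q))
        ∎

    ⊛-shiftˡ : ∀ p q → NonEmpty p → ((0# ∷ p) ⊛ q) ≈P (0# ∷ p ⊛ q)
    ⊛-shiftˡ (a ∷ p) q _ = ⊕-zerosˡ (0# ∷ (a ∷ p) ⊛ q) (scale-zero q) short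
      where
      short : length (scale 0# q) ≤ suc (length (scale a q ⊕ (0# ∷ p ⊛ q)))
      short = ≤-trans (≤-reflexive (≡.trans (length-map _ q) (≡.sym (length-map _ q))))
                      (≤-trans (length-⊕ˡ (scale a q) _) (n≤1+n _))

    ⊛-identityˡ : ∀ q → NonEmpty q → (one ⊛ q) ≈P q
    ⊛-identityˡ (b ∷ q) _ =
      trans (+-identityʳ _) (*-identityˡ b) ∷ ≈P-trans (≡⇒≈P (⊕-identityʳ (scale 1# q))) (scale-identity q)

    ⊛-identityʳ : ∀ p → (p ⊛ one) ≈P p
    ⊛-identityʳ []      = []
    ⊛-identityʳ (a ∷ p) = trans (+-identityʳ _) (*-identityʳ a) ∷ ⊛-identityʳ p

    ⊛-nonEmpty : ∀ p q → NonEmpty p → NonEmpty (p ⊛ q)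
    ⊛-nonEmpty (a ∷ p) []      _ = _
    ⊛-nonEmpty (a ∷ p) (_ ∷ _) _ = _

    mulLinear : A → Pol → Pol
    mulLinear a p = scale (- a) p ⊕ (0# ∷ p)

    mulLinear-cong : ∀ {a b p q} → a ≈ b → p ≈P q → mulLinear a p ≈P mulLinear b q
    mulLinear-cong a≈b p≈q = ⊕-cong (scale-cong (-‿cong a≈b) p≈q) (refl ∷ p≈q)

    mulLinear-nonEmpty : ∀ a p → NonEmpty (mulLinear a p)
    mulLinear-nonEmpty a []      = _
    mulLinear-nonEmpty a (_ ∷ _) = _

    X-⊛≈mulLinear : ∀ a q → NonEmpty q → ((X- a) ⊛ q) ≈P mulLinear a q
    X-⊛≈mulLinear a q q≢[] = ⊕-cong ≈P-refl (refl ∷ ⊛-identityˡ q q≢[])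

    mulLinear-⊛ : ∀ a p q → NonEmpty p → (mulLinear a p ⊛ q) ≈P mulLinear a (p ⊛ q)
    mulLinear-⊛ a p q p≢[] = begin
      (scale (- a) p ⊕ (0# ∷ p)) ⊛ q        ≈⟨ ⊛-distribʳ (scale (- a) p) (0# ∷ p) q ⟩
      (scale (- a) p ⊛ q) ⊕ ((0# ∷ p) ⊛ q)  ≈⟨ ⊕-cong (⊛-scaleˡ (- a) p q) (⊛-shiftˡ p q p≢[]) ⟩
      mulLinear a (p ⊛ q)                   ∎

    mulLinear-comm : ∀ a b p → mulLinear a (mulLinear b p) ≈P mulLinear b (mulLinear a p)
    mulLinear-comm a b p = begin
      mulLinear a (mulLinear b p)  ≈⟨ expand a b ⟩
      expanded a b           ≈⟨ ⊕-cong (scale-cong (*-comm (- a) (- b)) ≈P-refl) (refl ∷ swap-middle) ⟩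
      expanded b a           ≈⟨ expand b a ⟨
      mulLinear b (mulLinear a p)  ∎
      where
      expanded : A → A → Pol
      expanded a b = scale (- a * - b) p ⊕ (0# + 0# ∷ (scale (- a) p ⊕ (scale (- b) p ⊕ (0# ∷ p))))

      expand : ∀ a b → mulLinear a (mulLinear b p) ≈P expanded a b
      expand a b = begin
        scale (- a) (scale (- b) p ⊕ (0# ∷ p)) ⊕ (0# ∷ mulLinear b p)
          ≈⟨ ⊕-cong (scale-distribˡ (- a) (scale (- b) p) (0# ∷ p)) ≈P-refl ⟩
        (scale (- a) (scale (- b) p) ⊕ (- a * 0# ∷ scale (- a) p)) ⊕ (0# ∷ mulLinear b p)
          ≈⟨ ⊕-cong (⊕-cong (scale-assoc (- a) (- b) p) (zeroʳ (- a) ∷ ≈P-refl)) ≈P-refl ⟩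
        (scale (- a * - b) p ⊕ (0# ∷ scale (- a) p)) ⊕ (0# ∷ mulLinear b p)
          ≈⟨ ⊕-assoc (scale (- a * - b) p) (0# ∷ scale (- a) p) (0# ∷ mulLinear b p) ⟩
        expanded a b
          ∎

      swap-middle : (scale (- a) p ⊕ (scale (- b) p ⊕ (0# ∷ p))) ≈P (scale (- b) p ⊕ (scale (- a) p ⊕ (0# ∷ p)))
      swap-middle = begin
        scale (- a) p ⊕ (scale (- b) p ⊕ (0# ∷ p))  ≈⟨ ⊕-assoc (scale (- a) p) (scale (- b) p) (0# ∷ p) ⟨
        (scale (- a) p ⊕ scale (- b) p) ⊕ (0# ∷ p)  ≈⟨ ⊕-cong (⊕-comm (scale (- a) p) (scale (- b) p)) ≈P-refl ⟩
        (scale (- b) p ⊕ scale (- a) p) ⊕ (0# ∷ p)  ≈⟨ ⊕-assoc (scale (- b) p) (scale (- a) p) (0# ∷ p) ⟩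
        scale (- b) p ⊕ (scale (- a) p ⊕ (0# ∷ p))  ∎

    linearProduct : List A → Pol
    linearProduct as = prodP (map X-_ as)

    linearProduct-nonEmpty : ∀ as → NonEmpty (linearProduct as)
    linearProduct-nonEmpty []       = _
    linearProduct-nonEmpty (a ∷ as) = ⊛-nonEmpty (X- a) (linearProduct as) _

    linearProduct-⊛ : ∀ as q → NonEmpty q → (linearProduct as ⊛ q) ≈P foldr mulLinear q as
    linearProduct-⊛ []       q q≢[] = ⊛-identityˡ q q≢[]
    linearProduct-⊛ (a ∷ as) q q≢[] = begin
      ((X- a) ⊛ P) ⊛ q                    ≈⟨ ⊛-congˡ q (X-⊛≈mulLinear a P (linearProduct-nonEmpty as)) ⟩
      mulLinear a P ⊛ q                   ≈⟨ mulLinear-⊛ a P q (linearProduct-nonEmpty as) ⟩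
      mulLinear a (P ⊛ q)                 ≈⟨ mulLinear-cong refl (linearProduct-⊛ as q q≢[]) ⟩
      mulLinear a (foldr mulLinear q as)  ∎
      where P = linearProduct as

    linearProduct≈foldr : ∀ as → linearProduct as ≈P foldr mulLinear one as
    linearProduct≈foldr as = ≈P-trans (≈P-sym (⊛-identityʳ (linearProduct as))) (linearProduct-⊛ as one _)

    foldr-mulLinear-nonEmpty : ∀ as q → NonEmpty q → NonEmpty (foldr mulLinear q as)
    foldr-mulLinear-nonEmpty []       q q≢[] = q≢[]
    foldr-mulLinear-nonEmpty (a ∷ as) q _    = mulLinear-nonEmpty a (foldr mulLinear q as)

    foldr-mulLinear-cong : ∀ {as bs} q → Pointwise _≈_ as bs → foldr mulLinear q as ≈P foldr mulLinear q bs
    foldr-mulLinear-cong q []         = ≈P-refl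
    foldr-mulLinear-cong q (a≈b ∷ as≈) = mulLinear-cong a≈b (foldr-mulLinear-cong q as≈)

    foldr-mulLinear-↭ : ∀ {as bs} q → as ↭ bs → foldr mulLinear q as ≈P foldr mulLinear q bs
    foldr-mulLinear-↭ q ↭.refl         = ≈P-refl
    foldr-mulLinear-↭ q (↭.prep a π)   = mulLinear-cong refl (foldr-mulLinear-↭ q π)
    foldr-mulLinear-↭ q (↭.swap a b π) =
      ≈P-trans (mulLinear-cong refl (mulLinear-cong refl (foldr-mulLinear-↭ q π))) (mulLinear-comm a b _)
    foldr-mulLinear-↭ q (↭.trans π ρ)  = ≈P-trans (foldr-mulLinear-↭ q π) (foldr-mulLinear-↭ q ρ)

module CyclotomicProducts {c ℓ : Level} (R : CommutativeRing c ℓ) (ζ : CommutativeRing.Carrier R) where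
  open import Data.Nat as ℕ using (zero)
  open import Data.List using ([]; _∷_; _++_; map; foldr; concat)
  open import Data.List.Properties using (map-∘; map-++; foldr-++)
  open import Data.List.Relation.Binary.Pointwise as Pointwise using (Pointwise)
  open import Function using (_∘_)
  open import Algebra.Properties.Semiring.Exp (CommutativeRing.semiring R) using (_^_; ^-assocʳ)
  open import Relation.Binary.PropositionalEquality as ≡ using (_≡_)
  open CommutativeRing R renaming (Carrier to A)
  open Poly R
  open Polynomials using (NonEmpty)
  open Polynomials.LinearFactors R
  open Residues using (unitaryResidues; coprimeResidues; gcdClass)
  open import Relation.Binary.Reasoning.Setoid polySetoid

  pow≡^ : ∀ a k → pow a k ≡ a ^ k
  pow≡^ a zero    = ≡.refl
  pow≡^ a (suc k) = ≡.cong (a *_) (pow≡^ a k)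

  pow-pow : ∀ m k → pow (pow ζ m) k ≈ pow ζ (m ℕ.* k)
  pow-pow m k rewrite pow≡^ (pow ζ m) k | pow≡^ ζ m | pow≡^ ζ (m ℕ.* k) = ^-assocʳ ζ m k

  unitaryCyclotomic≈ : ∀ n → unitaryCyclotomic ζ n ≈P foldr mulLinear one (map (pow ζ) (unitaryResidues n))
  unitaryCyclotomic≈ n = begin
    unitaryCyclotomic ζ n                              ≡⟨ ≡.cong prodP (map-∘ (unitaryResidues n)) ⟩
    linearProduct (map (pow ζ) (unitaryResidues n))    ≈⟨ linearProduct≈foldr (map (pow ζ) (unitaryResidues n)) ⟩
    foldr mulLinear one (map (pow ζ) (unitaryResidues n)) ∎

  cyclotomic-⊛ : ∀ n d q → NonEmpty q →
                 (cyclotomic (pow ζ (n ℕ./ suc d)) (suc d) ⊛ q) ≈P foldr mulLinear q (map (pow ζ) (gcdClass n d))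
  cyclotomic-⊛ n d q q≢[] = begin
    cyclotomic (pow ζ m) (suc d) ⊛ q                ≡⟨ ≡.cong (λ P → prodP P ⊛ q) (map-∘ K) ⟩
    linearProduct (map (pow (pow ζ m)) K) ⊛ q       ≈⟨ linearProduct-⊛ (map (pow (pow ζ m)) K) q q≢[] ⟩
    foldr mulLinear q (map (pow (pow ζ m)) K)          ≈⟨ foldr-mulLinear-cong q m-th-powers ⟩
    foldr mulLinear q (map (pow ζ ∘ (m ℕ.*_)) K)       ≡⟨ ≡.cong (foldr mulLinear q) (map-∘ K) ⟩
    foldr mulLinear q (map (pow ζ) (gcdClass n d))     ∎
    where
    m = n ℕ./ suc d
    K = coprimeResidues (suc d)
    m-th-powers : Pointwise _≈_ (map (pow (pow ζ m)) K) (map (pow ζ ∘ (m ℕ.*_)) K)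
    m-th-powers = Pointwise.map⁺ (pow (pow ζ m)) (pow ζ ∘ (m ℕ.*_)) (Pointwise.refl (pow-pow m _))

  cyclotomicProduct≈ : ∀ n ds → prodP (map (λ d → cyclotomic (pow ζ (n ℕ./ suc d)) (suc d)) ds)
                                ≈P foldr mulLinear one (map (pow ζ) (concat (map (gcdClass n) ds)))
  cyclotomicProduct≈ n []       = ≈P-refl
  cyclotomicProduct≈ n (d ∷ ds) = begin
    Φ d ⊛ prodP (map Φ ds)
      ≈⟨ ⊛-congʳ (Φ d) (cyclotomicProduct≈ n ds) ⟩
    Φ d ⊛ foldr mulLinear one rest
      ≈⟨ cyclotomic-⊛ n d _ (foldr-mulLinear-nonEmpty rest one _) ⟩
    foldr mulLinear (foldr mulLinear one rest) (map (pow ζ) (gcdClass n d))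
      ≡⟨ foldr-++ mulLinear one (map (pow ζ) (gcdClass n d)) rest ⟨
    foldr mulLinear one (map (pow ζ) (gcdClass n d) ++ rest)
      ≡⟨ ≡.cong (foldr mulLinear one) (map-++ (pow ζ) (gcdClass n d) _) ⟨
    foldr mulLinear one (map (pow ζ) (concat (map (gcdClass n) (d ∷ ds))))
      ∎
    where
    Φ : ℕ → Pol
    Φ d = cyclotomic (pow ζ (n ℕ./ suc d)) (suc d)
    rest = map (pow ζ) (concat (map (gcdClass n) ds))

theorem2 : {c ℓ : Level} (R : CommutativeRing c ℓ) (n : ℕ) (ζ : CommutativeRing.Carrier R) →
    Poly.PrimitiveRoot R ζ (suc n) →
    Poly._≈P_ R (Poly.unitaryCyclotomic R ζ (suc n)) (Poly.kernelCyclotomicProduct R ζ (suc n))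
theorem2 R n ζ _ = begin
  unitaryCyclotomic ζ N
    ≈⟨ unitaryCyclotomic≈ N ⟩
  foldr mulLinear one (map (pow ζ) (unitaryResidues N))
    ≈⟨ foldr-mulLinear-↭ one (↭.map⁺ (pow ζ) (unitaryResidues↭gcdClasses N)) ⟩
  foldr mulLinear one (map (pow ζ) (concat (map (gcdClass N) (kernelDivisors N))))
    ≈⟨ cyclotomicProduct≈ N (kernelDivisors N) ⟨
  kernelCyclotomicProduct ζ N
    ∎
  where
  open import Data.List using (map; foldr; concat)
  import Data.List.Relation.Binary.Permutation.Propositional.Properties as ↭
  open Poly R
  open Polynomials.LinearFactors R
  open CyclotomicProducts R ζ
  open Residues using (unitaryResidues; gcdClass; kernelDivisors; unitaryResidues↭gcdClasses)
  open import Relation.Binary.Reasoning.Setoid polySetoid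
  N = suc n
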